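{- Let $M=(V,D)$ be a $\Delta$-matroid and $u\in V$. If $M$ is divisible by $u$, then $q_1(M)=q_1(M\setminus u)+q_1(M*u\setminus u)$. If $M$ is not divisible, then $q_1(M)=(y+1)^n$ where $n=|V|$.
   Context: A set system is $M=(V,D)$ with $V$ finite, $D$ a family of subsets of $V$; write $Z\in M$ for $Z\in D$; it is proper if $D\neq\emptyset$. $\oplus$ is symmetric difference. $M*X=(V,\{Z\oplus X:Z\in D\})$; $M\setminus u=(V\setminus\{u\},\{Z\in D:u\notin Z\})$; operations apply left to right, so $M*u\setminus u=(M*u)\setminus u$. For proper $M$, $d_M(X)=\min\{|X\oplus Z|:Z\in M\}$, $d_M=d_M(\emptyset)$, and $q_1(M)=\sum_{X\subseteq V}y^{d_{M*X}}$. A $\Delta$-matroid is a proper set system such that for all $X,Y\in M$ and all $w\in X\oplus Y$, either $X\oplus\{w\}\in M$ or there is $v\in X\oplus Y$, $v\neq w$, with $X\oplus\{w,v\}\in M$. $M$ is divisible by $u$ if there are $X_1,X_2\in M$ with $u\in X_1\oplus X_2$; $M$ is divisible if it is divisible by some $u\in V$. -}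

module Defs where

open import Data.Nat using (ℕ; zero; suc; _+_; _⊓_; _≟_)
open import Data.Bool using (Bool; true; false; _xor_)
open import Data.Fin using (Fin)
open import Data.Fin.Subset using (Subset; _∈_; _⊆_; ⁅_⁆; ∣_∣; ⊥; inside; outside; _─_; _∪_)
open import Data.Fin.Subset.Properties using (_⊆?_; _∈?_)
open import Data.Vec using (Vec; []; _∷_; zipWith)
open import Data.List using (List; []; _∷_; map; filter; length; _++_)
import Data.List.Membership.Propositional as LM
open import Data.Product using (Σ; ∃; _×_; _,_)
open import Data.Sum using (_⊎_)
open import Relation.Nullary using (¬_; ¬?)
open import Relation.Binary.PropositionalEquality using (_≡_; _≢_)

-- Ground universe Fin n; a set system is (V , D) with V ⊆ Fin n and
-- D a (finite) list of subsets of Fin n (duplicates harmless).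
record SetSystem (n : ℕ) : Set where
  constructor _,_
  field
    ground : Subset n
    family : List (Subset n)
open SetSystem public

WellFormed : ∀ {n} → SetSystem n → Set
WellFormed M = ∀ Z → Z LM.∈ family M → Z ⊆ ground M

_∈M_ : ∀ {n} → Subset n → SetSystem n → Set
Z ∈M M = Z LM.∈ family M

Proper : ∀ {n} → SetSystem n → Set
Proper M = ∃ λ Z → Z ∈M M

_⊕_ : ∀ {n} → Subset n → Subset n → Subset n
_⊕_ = zipWith _xor_

_*_ : ∀ {n} → SetSystem n → Subset n → SetSystem n
(V , D) * X = V , map (λ Z → Z ⊕ X) D

_∖_ : ∀ {n} → SetSystem n → Fin n → SetSystem n
(V , D) ∖ u = (V ─ ⁅ u ⁆) , filter (λ Z → ¬? (u ∈? Z)) D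

-- minimum of a list of naturals (default 0 for the empty list; only used
-- for proper set systems)
minList : List ℕ → ℕ
minList [] = 0
minList (x ∷ []) = x
minList (x ∷ y ∷ xs) = x ⊓ minList (y ∷ xs)

dist : ∀ {n} → SetSystem n → Subset n → ℕ
dist M X = minList (map (λ Z → ∣ X ⊕ Z ∣) (family M))

d : ∀ {n} → SetSystem n → ℕ
d M = dist M ⊥

allSubsets : (n : ℕ) → List (Subset n)
allSubsets zero = [] ∷ []
allSubsets (suc n) = map (outside ∷_) (allSubsets n) ++ map (inside ∷_) (allSubsets n)

subsetsOf : ∀ {n} → Subset n → List (Subset n)
subsetsOf {n} V = filter (λ X → X ⊆? V) (allSubsets n)

-- Polynomials in y with natural coefficients, as coefficient functions
-- (coefficient of y^k); equality is pointwise equality of coefficients.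
Poly : Set
Poly = ℕ → ℕ

_+ₚ_ : Poly → Poly → Poly
(p +ₚ q) k = p k + q k

_≈ₚ_ : Poly → Poly → Set
p ≈ₚ q = ∀ k → p k ≡ q k

yTimes : Poly → Poly
yTimes p zero = 0
yTimes p (suc k) = p k

y+1^ : ℕ → Poly
y+1^ zero zero = 1
y+1^ zero (suc k) = 0
y+1^ (suc n) = yTimes (y+1^ n) +ₚ y+1^ n

-- q_1(M) = Σ_{X ⊆ V} y^{d_{M*X}} : coefficient of y^k is the number of
-- X ⊆ V with d_{M*X} = k.
q₁ : ∀ {n} → SetSystem n → Poly
q₁ M k = length (filter (λ X → d (M * X) ≟ k) (subsetsOf (ground M)))

IsDeltaMatroid : ∀ {n} → SetSystem n → Set
IsDeltaMatroid M =
  Proper M ×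
  (∀ X Y → X ∈M M → Y ∈M M → ∀ w → w ∈ (X ⊕ Y) →
     ((X ⊕ ⁅ w ⁆) ∈M M) ⊎
     (∃ λ v → v ∈ (X ⊕ Y) × v ≢ w × ((X ⊕ (⁅ w ⁆ ∪ ⁅ v ⁆)) ∈M M)))

DivisibleBy : ∀ {n} → SetSystem n → Fin n → Set
DivisibleBy M u = ∃ λ X₁ → ∃ λ X₂ → X₁ ∈M M × X₂ ∈M M × u ∈ (X₁ ⊕ X₂)

Divisible : ∀ {n} → SetSystem n → Set
Divisible M = ∃ λ u → u ∈ ground M × DivisibleBy M u

module Submission where

-- Let Zin, Zout be members of M with u ∈ Zin and u ∉ Zout. The subsets of V
-- pair up as X, X ⊕ {u} with u ∉ X. By the exchange axiom, every member of M containing u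
-- can be replaced by a member avoiding u that is no farther from such an X, so
-- d_{M*X} = d_{(M∖u)*X}; the twist M*u is again a Δ-matroid, and the same argument gives
-- d_{M*(X⊕u)} = d_{(M*u∖u)*X}. Summing over the pairs yields the recursion. If M is not
-- divisible, all its members agree on V, so M has a single member Z ⊆ V and d_{M*X} = |X ⊕ Z|,
-- which takes the value k for exactly (|V| choose k) subsets X ⊆ V.

open import Defs
open import Algebra.Bundles using (CommutativeSemigroup)
import Algebra.Properties.CommutativeSemigroup as CommutativeSemigroupProperties
open import Data.Bool using (true; false; _xor_; if_then_else_)
open import Data.Bool.Properties using (xor-assoc; xor-comm; xor-identityˡ; xor-identityʳ; xor-same)
open import Data.Fin using (Fin; zero; suc)
open import Data.Fin.Subset
  using (Subset; Empty; _∈_; _∉_; _⊆_; _-_; _─_; ⁅_⁆; ∣_∣; ⊥; inside; outside; _∪_)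
open import Data.Fin.Subset.Properties
  using ( _∈?_; _⊆?_; drop-there; drop-∷-⊆; out⊆; in⊆in; x∈⁅x⁆; x∈p∪q⁺; ∪-identityˡ; ∪-identityʳ
        ; p─⊥≡p; Empty-unique)
open import Data.List using (List; []; _∷_; _++_; map; filter; length)
open import Data.List.Properties using (map-++; map-∘; map-cong)
open import Data.List.Membership.Propositional using () renaming (_∈_ to _∈ₗ_)
open import Data.List.Membership.Propositional.Properties using (∈-map⁺; ∈-map⁻; ∈-filter⁺; ∈-filter⁻)
import Data.List.Relation.Unary.Any as Any
open import Data.Nat using (ℕ; zero; suc; _+_; _≤_; _≟_)
open import Data.Nat.ListAction using (sum)
open import Data.Nat.ListAction.Properties using (sum-++)
open import Data.Nat.Properties
  using ( ≤-refl; ≤-reflexive; ≤-trans; ≤-antisym; n≤1+n; m≤n⇒m≤1+n; m⊓n≤m; m⊓n≤n; ⊓-sel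
        ; +-comm; +-identityʳ; +-commutativeSemigroup; module ≤-Reasoning)
open import Data.Product using (_×_; _,_; ∃; ∃₂; proj₁; proj₂)
import Data.Product as Product
open import Data.Sum using (_⊎_; inj₁; inj₂; [_,_]′)
import Data.Sum as Sum
open import Data.Vec using ([]; _∷_; here; there)
open import Data.Vec.Properties using (zipWith-assoc; zipWith-comm; zipWith-identityˡ; zipWith-identityʳ)
open import Function using (_∘_)
open import Level using (0ℓ)
open import Relation.Nullary using (¬_; ¬?; Dec; does; yes; no; contradiction)
open import Relation.Unary using (Decidable)
open import Relation.Binary.PropositionalEquality
  using (_≡_; _≢_; refl; sym; trans; cong; cong₂; subst; isEquivalence; module ≡-Reasoning)

private variable
  n : ℕ
  x : Fin n
  p q : Subset n

⊕-assoc : ∀ (p q r : Subset n) → (p ⊕ q) ⊕ r ≡ p ⊕ (q ⊕ r)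
⊕-assoc = zipWith-assoc xor-assoc

⊕-comm : ∀ (p q : Subset n) → p ⊕ q ≡ q ⊕ p
⊕-comm = zipWith-comm xor-comm

⊕-identityˡ : ∀ (p : Subset n) → ⊥ ⊕ p ≡ p
⊕-identityˡ = zipWith-identityˡ xor-identityˡ

⊕-identityʳ : ∀ (p : Subset n) → p ⊕ ⊥ ≡ p
⊕-identityʳ = zipWith-identityʳ xor-identityʳ

⊕-same : ∀ (p : Subset n) → p ⊕ p ≡ ⊥
⊕-same [] = refl
⊕-same (s ∷ p) = cong₂ _∷_ (xor-same s) (⊕-same p)

p⊕q≡⊥⇒p≡q : ∀ {p q : Subset n} → p ⊕ q ≡ ⊥ → p ≡ q
p⊕q≡⊥⇒p≡q {p = p} {q} p⊕q≡⊥ = begin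
  p              ≡⟨ ⊕-identityʳ p ⟨
  p ⊕ ⊥          ≡⟨ cong (p ⊕_) (⊕-same q) ⟨
  p ⊕ (q ⊕ q)    ≡⟨ ⊕-assoc p q q ⟨
  (p ⊕ q) ⊕ q    ≡⟨ cong (_⊕ q) p⊕q≡⊥ ⟩
  ⊥ ⊕ q          ≡⟨ ⊕-identityˡ q ⟩
  q              ∎
  where open ≡-Reasoning

⊕-commutativeSemigroup : ℕ → CommutativeSemigroup 0ℓ 0ℓ
⊕-commutativeSemigroup n = record
  { Carrier = Subset n
  ; _≈_ = _≡_
  ; _∙_ = _⊕_
  ; isCommutativeSemigroup = record
    { isSemigroup = record
      { isMagma = record { isEquivalence = isEquivalence ; ∙-cong = cong₂ _⊕_ }
      ; assoc = ⊕-assoc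
      }
    ; comm = ⊕-comm
    }
  }

module ⊕-Properties {n} = CommutativeSemigroupProperties (⊕-commutativeSemigroup n)

[p⊕r]⊕[q⊕r]≡p⊕q : ∀ (p q r : Subset n) → (p ⊕ r) ⊕ (q ⊕ r) ≡ p ⊕ q
[p⊕r]⊕[q⊕r]≡p⊕q p q r = begin
  (p ⊕ r) ⊕ (q ⊕ r)  ≡⟨ ⊕-Properties.interchange p r q r ⟩
  (p ⊕ q) ⊕ (r ⊕ r)  ≡⟨ cong ((p ⊕ q) ⊕_) (⊕-same r) ⟩
  (p ⊕ q) ⊕ ⊥        ≡⟨ ⊕-identityʳ (p ⊕ q) ⟩
  p ⊕ q              ∎
  where open ≡-Reasoning

x∈p⊕q⁺ : (x ∈ p × x ∉ q) ⊎ (x ∉ p × x ∈ q) → x ∈ p ⊕ q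
x∈p⊕q⁺ {q = outside ∷ q} (inj₁ (here , _)) = here
x∈p⊕q⁺ {q = inside ∷ q} (inj₁ (here , x∉q)) = contradiction here x∉q
x∈p⊕q⁺ {p = outside ∷ p} (inj₂ (_ , here)) = here
x∈p⊕q⁺ {p = inside ∷ p} (inj₂ (x∉p , here)) = contradiction here x∉p
x∈p⊕q⁺ {p = _ ∷ _} {q = _ ∷ _} (inj₁ (there x∈p , x∉q)) = there (x∈p⊕q⁺ (inj₁ (x∈p , x∉q ∘ there)))
x∈p⊕q⁺ {p = _ ∷ _} {q = _ ∷ _} (inj₂ (x∉p , there x∈q)) = there (x∈p⊕q⁺ (inj₂ (x∉p ∘ there , x∈q)))

x∈p⊕q⁻ : ∀ (p q : Subset n) → x ∈ p ⊕ q → (x ∈ p × x ∉ q) ⊎ (x ∉ p × x ∈ q)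
x∈p⊕q⁻ (inside ∷ p) (outside ∷ q) here = inj₁ (here , λ ())
x∈p⊕q⁻ (outside ∷ p) (inside ∷ q) here = inj₂ ((λ ()) , here)
x∈p⊕q⁻ (_ ∷ p) (_ ∷ q) (there x∈p⊕q) =
  Sum.map (Product.map there (_∘ drop-there)) (Product.map (_∘ drop-there) there) (x∈p⊕q⁻ p q x∈p⊕q)

x∈p∧x∈q⇒x∉p⊕q : x ∈ p → x ∈ q → x ∉ p ⊕ q
x∈p∧x∈q⇒x∉p⊕q here here ()
x∈p∧x∈q⇒x∉p⊕q (there x∈p) (there x∈q) (there x∈p⊕q) = x∈p∧x∈q⇒x∉p⊕q x∈p x∈q x∈p⊕q

⁅x⁆∪⁅y⁆≡⁅x⁆⊕⁅y⁆ : ∀ {x y : Fin n} → x ≢ y → ⁅ x ⁆ ∪ ⁅ y ⁆ ≡ ⁅ x ⁆ ⊕ ⁅ y ⁆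
⁅x⁆∪⁅y⁆≡⁅x⁆⊕⁅y⁆ {x = zero} {zero} x≢y = contradiction refl x≢y
⁅x⁆∪⁅y⁆≡⁅x⁆⊕⁅y⁆ {x = zero} {suc y} _ = cong (inside ∷_) (trans (∪-identityˡ ⁅ y ⁆) (sym (⊕-identityˡ ⁅ y ⁆)))
⁅x⁆∪⁅y⁆≡⁅x⁆⊕⁅y⁆ {x = suc x} {zero} _ = cong (inside ∷_) (trans (∪-identityʳ ⁅ x ⁆) (sym (⊕-identityʳ ⁅ x ⁆)))
⁅x⁆∪⁅y⁆≡⁅x⁆⊕⁅y⁆ {x = suc x} {suc y} x≢y = cong (outside ∷_) (⁅x⁆∪⁅y⁆≡⁅x⁆⊕⁅y⁆ (x≢y ∘ cong suc))

x∉p-x : ∀ (p : Subset n) x → x ∉ p - x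
x∉p-x (inside ∷ p) zero ()
x∉p-x (outside ∷ p) zero ()
x∉p-x (_ ∷ p) (suc x) (there x∈p-x) = x∉p-x p x x∈p-x

x∈p⇒1+∣p⊕⁅x⁆∣≡∣p∣ : x ∈ p → suc ∣ p ⊕ ⁅ x ⁆ ∣ ≡ ∣ p ∣
x∈p⇒1+∣p⊕⁅x⁆∣≡∣p∣ (here {xs = p}) = cong (suc ∘ ∣_∣) (⊕-identityʳ p)
x∈p⇒1+∣p⊕⁅x⁆∣≡∣p∣ {p = inside ∷ _} (there x∈p) = cong suc (x∈p⇒1+∣p⊕⁅x⁆∣≡∣p∣ x∈p)
x∈p⇒1+∣p⊕⁅x⁆∣≡∣p∣ {p = outside ∷ _} (there x∈p) = x∈p⇒1+∣p⊕⁅x⁆∣≡∣p∣ x∈p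

x∈p⇒∣p⊕⁅x⁆∣≤∣p∣ : x ∈ p → ∣ p ⊕ ⁅ x ⁆ ∣ ≤ ∣ p ∣
x∈p⇒∣p⊕⁅x⁆∣≤∣p∣ x∈p = ≤-trans (n≤1+n _) (≤-reflexive (x∈p⇒1+∣p⊕⁅x⁆∣≡∣p∣ x∈p))

x∉p⇒∣p⊕⁅x⁆∣≡1+∣p∣ : x ∉ p → ∣ p ⊕ ⁅ x ⁆ ∣ ≡ suc ∣ p ∣
x∉p⇒∣p⊕⁅x⁆∣≡1+∣p∣ {x = zero} {p = inside ∷ _} x∉p = contradiction here x∉p
x∉p⇒∣p⊕⁅x⁆∣≡1+∣p∣ {x = zero} {p = outside ∷ p} _ = cong (suc ∘ ∣_∣) (⊕-identityʳ p)
x∉p⇒∣p⊕⁅x⁆∣≡1+∣p∣ {x = suc _} {p = inside ∷ _} x∉p = cong suc (x∉p⇒∣p⊕⁅x⁆∣≡1+∣p∣ (x∉p ∘ there))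
x∉p⇒∣p⊕⁅x⁆∣≡1+∣p∣ {x = suc _} {p = outside ∷ _} x∉p = x∉p⇒∣p⊕⁅x⁆∣≡1+∣p∣ (x∉p ∘ there)

∣p⊕⁅x⁆∣≤1+∣p∣ : ∀ (p : Subset n) x → ∣ p ⊕ ⁅ x ⁆ ∣ ≤ suc ∣ p ∣
∣p⊕⁅x⁆∣≤1+∣p∣ p x with x ∈? p
... | yes x∈p = m≤n⇒m≤1+n (x∈p⇒∣p⊕⁅x⁆∣≤∣p∣ x∈p)
... | no x∉p = ≤-reflexive (x∉p⇒∣p⊕⁅x⁆∣≡1+∣p∣ x∉p)

minList-≤ : ∀ {m} {ms : List ℕ} → m ∈ₗ ms → minList ms ≤ m
minList-≤ {ms = _ ∷ []} (Any.here refl) = ≤-refl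
minList-≤ {ms = _ ∷ _ ∷ _} (Any.here refl) = m⊓n≤m _ _
minList-≤ {ms = m ∷ _ ∷ _} (Any.there m∈ms) = ≤-trans (m⊓n≤n m _) (minList-≤ m∈ms)

minList-∈ : ∀ m ms → minList (m ∷ ms) ∈ₗ m ∷ ms
minList-∈ m [] = Any.here refl
minList-∈ m (m′ ∷ ms) with ⊓-sel m (minList (m′ ∷ ms))
... | inj₁ eq = Any.here eq
... | inj₂ eq = Any.there (subst (_∈ₗ m′ ∷ ms) (sym eq) (minList-∈ m′ ms))

minList-map-∈ : ∀ {A : Set} (f : A → ℕ) {b : A} {bs : List A} → b ∈ₗ bs →
                ∃ λ a → a ∈ₗ bs × minList (map f bs) ≡ f a
minList-map-∈ f {bs = b ∷ bs} _ = ∈-map⁻ f (minList-∈ (f b) (map f bs))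

minList-map-mono : ∀ {A : Set} (f : A → ℕ) {as bs : List A} {b : A} → b ∈ₗ bs →
                   (∀ {b} → b ∈ₗ bs → ∃ λ a → a ∈ₗ as × f a ≤ f b) →
                   minList (map f as) ≤ minList (map f bs)
minList-map-mono f b∈bs dominated with minList-map-∈ f b∈bs
... | b , b∈bs , min≡fb with dominated b∈bs
...   | a , a∈as , fa≤fb = ≤-trans (minList-≤ (∈-map⁺ f a∈as)) (≤-trans fa≤fb (≤-reflexive (sym min≡fb)))

indicator : ∀ {a} {A : Set a} → Dec A → ℕ
indicator A? = if does A? then 1 else 0

length-filter : ∀ {A : Set} {P : A → Set} (P? : Decidable P) xs →
                length (filter P? xs) ≡ sum (map (indicator ∘ P?) xs)
length-filter P? [] = refl
length-filter P? (x ∷ xs) with does (P? x)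
... | true = cong suc (length-filter P? xs)
... | false = length-filter P? xs

sum-map-filter : ∀ {A : Set} {Q : A → Set} (Q? : Decidable Q) (g : A → ℕ) xs →
                 sum (map g (filter Q? xs)) ≡ sum (map (λ x → if does (Q? x) then g x else 0) xs)
sum-map-filter Q? g [] = refl
sum-map-filter Q? g (x ∷ xs) with does (Q? x)
... | true = cong (g x +_) (sum-map-filter Q? g xs)
... | false = sum-map-filter Q? g xs

sumSubsets : Subset n → (Subset n → ℕ) → ℕ
sumSubsets [] g = g []
sumSubsets (outside ∷ V) g = sumSubsets V (g ∘ (outside ∷_))
sumSubsets (inside ∷ V) g = sumSubsets V (g ∘ (outside ∷_)) + sumSubsets V (g ∘ (inside ∷_))

sum-map-const-0 : ∀ {A : Set} (xs : List A) → sum (map (λ _ → 0) xs) ≡ 0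
sum-map-const-0 [] = refl
sum-map-const-0 (_ ∷ xs) = sum-map-const-0 xs

sum-allSubsets : ∀ n (V : Subset n) (g : Subset n → ℕ) →
                 sum (map (λ X → if does (X ⊆? V) then g X else 0) (allSubsets n)) ≡ sumSubsets V g
sum-allSubsets zero [] g = +-identityʳ (g [])
sum-allSubsets (suc n) (v ∷ V) g = begin
  sum (map h (map (outside ∷_) Xs ++ map (inside ∷_) Xs))
    ≡⟨ cong sum (map-++ h (map (outside ∷_) Xs) _) ⟩
  sum (map h (map (outside ∷_) Xs) ++ map h (map (inside ∷_) Xs))
    ≡⟨ sum-++ (map h (map (outside ∷_) Xs)) _ ⟩
  sum (map h (map (outside ∷_) Xs)) + sum (map h (map (inside ∷_) Xs))
    ≡⟨ cong₂ _+_ (cong sum (sym (map-∘ Xs))) (cong sum (sym (map-∘ Xs))) ⟩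
  sum (map (h ∘ (outside ∷_)) Xs) + sum (map (h ∘ (inside ∷_)) Xs)
    ≡⟨ split v ⟩
  sumSubsets (v ∷ V) g ∎
  where
  open ≡-Reasoning
  Xs = allSubsets n
  h = λ X → if does (X ⊆? (v ∷ V)) then g X else 0
  split : ∀ v → sum (map (λ X → if does ((outside ∷ X) ⊆? (v ∷ V)) then g (outside ∷ X) else 0) Xs)
                + sum (map (λ X → if does ((inside ∷ X) ⊆? (v ∷ V)) then g (inside ∷ X) else 0) Xs)
              ≡ sumSubsets (v ∷ V) g
  split outside = trans (cong₂ _+_ (sum-allSubsets n V (g ∘ (outside ∷_))) (sum-map-const-0 Xs)) (+-identityʳ _)
  split inside = cong₂ _+_ (sum-allSubsets n V (g ∘ (outside ∷_))) (sum-allSubsets n V (g ∘ (inside ∷_)))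

q₁≡sumSubsets : ∀ (M : SetSystem n) k → q₁ M k ≡ sumSubsets (ground M) (λ X → indicator (d (M * X) ≟ k))
q₁≡sumSubsets {n} M k = begin
  length (filter P? (subsetsOf (ground M)))            ≡⟨ length-filter P? (subsetsOf (ground M)) ⟩
  sum (map (indicator ∘ P?) (subsetsOf (ground M)))     ≡⟨ sum-map-filter (_⊆? ground M) (indicator ∘ P?) (allSubsets n) ⟩
  sum (map (λ X → if does (X ⊆? ground M) then indicator (P? X) else 0) (allSubsets n))
                                                        ≡⟨ sum-allSubsets n (ground M) (indicator ∘ P?) ⟩
  sumSubsets (ground M) (indicator ∘ P?) ∎
  where
  open ≡-Reasoning
  P? = λ X → d (M * X) ≟ k

sumSubsets-cong : ∀ (V : Subset n) {g h : Subset n → ℕ} →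
                  (∀ {X} → X ⊆ V → g X ≡ h X) → sumSubsets V g ≡ sumSubsets V h
sumSubsets-cong [] g≡h = g≡h λ ()
sumSubsets-cong (outside ∷ V) g≡h = sumSubsets-cong V (g≡h ∘ out⊆)
sumSubsets-cong (inside ∷ V) g≡h = cong₂ _+_ (sumSubsets-cong V (g≡h ∘ out⊆)) (sumSubsets-cong V (g≡h ∘ in⊆in))

module +-Properties = CommutativeSemigroupProperties +-commutativeSemigroup

sumSubsets-+ : ∀ (V : Subset n) (g h : Subset n → ℕ) →
               sumSubsets V (λ X → g X + h X) ≡ sumSubsets V g + sumSubsets V h
sumSubsets-+ [] g h = refl
sumSubsets-+ (outside ∷ V) g h = sumSubsets-+ V (g ∘ (outside ∷_)) (h ∘ (outside ∷_))
sumSubsets-+ (inside ∷ V) g h = trans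
  (cong₂ _+_ (sumSubsets-+ V (g ∘ (outside ∷_)) (h ∘ (outside ∷_)))
             (sumSubsets-+ V (g ∘ (inside ∷_)) (h ∘ (inside ∷_))))
  (+-Properties.interchange (sumSubsets V (g ∘ (outside ∷_))) (sumSubsets V (h ∘ (outside ∷_)))
                            (sumSubsets V (g ∘ (inside ∷_))) (sumSubsets V (h ∘ (inside ∷_))))

sumSubsets-zero : ∀ (V : Subset n) → sumSubsets V (λ _ → 0) ≡ 0
sumSubsets-zero [] = refl
sumSubsets-zero (outside ∷ V) = sumSubsets-zero V
sumSubsets-zero (inside ∷ V) = cong₂ _+_ (sumSubsets-zero V) (sumSubsets-zero V)

sumSubsets-pairs : ∀ {V : Subset n} {x} → x ∈ V → ∀ g →
                   sumSubsets V g ≡ sumSubsets (V - x) (λ X → g X + g (X ⊕ ⁅ x ⁆))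
sumSubsets-pairs (here {xs = V}) g = begin
  sumSubsets V (g ∘ (outside ∷_)) + sumSubsets V (g ∘ (inside ∷_))
    ≡⟨ cong (sumSubsets V (g ∘ (outside ∷_)) +_)
         (sumSubsets-cong V λ {X} _ → cong (g ∘ (inside ∷_)) (sym (⊕-identityʳ X))) ⟩
  sumSubsets V (g ∘ (outside ∷_)) + sumSubsets V (λ X → g (inside ∷ (X ⊕ ⊥)))
    ≡⟨ sym (sumSubsets-+ V _ _) ⟩
  sumSubsets V (λ X → g (outside ∷ X) + g (inside ∷ (X ⊕ ⊥)))
    ≡⟨ cong (λ W → sumSubsets W (λ X → g (outside ∷ X) + g (inside ∷ (X ⊕ ⊥)))) (sym (p─⊥≡p V)) ⟩
  sumSubsets (V ─ ⊥) (λ X → g (outside ∷ X) + g (inside ∷ (X ⊕ ⊥))) ∎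
  where open ≡-Reasoning
sumSubsets-pairs {V = outside ∷ V} (there x∈V) g = sumSubsets-pairs x∈V (g ∘ (outside ∷_))
sumSubsets-pairs {V = inside ∷ V} (there x∈V) g =
  cong₂ _+_ (sumSubsets-pairs x∈V (g ∘ (outside ∷_))) (sumSubsets-pairs x∈V (g ∘ (inside ∷_)))

sumSubsets-≟-suc : ∀ (V : Subset n) (f : Subset n → ℕ) {m} →
                   (∀ k → sumSubsets V (λ X → indicator (f X ≟ k)) ≡ y+1^ m k) →
                   ∀ k → sumSubsets V (λ X → indicator (suc (f X) ≟ k)) + sumSubsets V (λ X → indicator (f X ≟ k))
                         ≡ y+1^ (suc m) k
sumSubsets-≟-suc V f counts zero = cong₂ _+_ (sumSubsets-zero V) (counts zero)
sumSubsets-≟-suc V f counts (suc k) = cong₂ _+_ (counts k) (counts (suc k))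

sumSubsets-∣⊕∣≡ : ∀ {V Z : Subset n} → Z ⊆ V →
                  ∀ k → sumSubsets V (λ X → indicator (∣ X ⊕ Z ∣ ≟ k)) ≡ y+1^ ∣ V ∣ k
sumSubsets-∣⊕∣≡ {V = []} {[]} _ zero = refl
sumSubsets-∣⊕∣≡ {V = []} {[]} _ (suc k) = refl
sumSubsets-∣⊕∣≡ {V = outside ∷ V} {outside ∷ Z} Z⊆V = sumSubsets-∣⊕∣≡ (drop-∷-⊆ Z⊆V)
sumSubsets-∣⊕∣≡ {V = outside ∷ V} {inside ∷ Z} Z⊆V with () ← Z⊆V here
sumSubsets-∣⊕∣≡ {V = inside ∷ V} {outside ∷ Z} Z⊆V k =
  trans (+-comm (sumSubsets V (λ X → indicator (∣ X ⊕ Z ∣ ≟ k))) _)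
        (sumSubsets-≟-suc V (λ X → ∣ X ⊕ Z ∣) {∣ V ∣} (sumSubsets-∣⊕∣≡ (drop-∷-⊆ Z⊆V)) k)
sumSubsets-∣⊕∣≡ {V = inside ∷ V} {inside ∷ Z} Z⊆V =
  sumSubsets-≟-suc V (λ X → ∣ X ⊕ Z ∣) {∣ V ∣} (sumSubsets-∣⊕∣≡ (drop-∷-⊆ Z⊆V))

d-*≡dist : ∀ (M : SetSystem n) X → d (M * X) ≡ dist M X
d-*≡dist M X = cong minList (begin
  map (λ Z → ∣ ⊥ ⊕ Z ∣) (map (_⊕ X) (family M))  ≡⟨ map-∘ (family M) ⟨
  map (λ Z → ∣ ⊥ ⊕ (Z ⊕ X) ∣) (family M)
    ≡⟨ map-cong (λ Z → cong ∣_∣ (trans (⊕-identityˡ (Z ⊕ X)) (⊕-comm Z X))) (family M) ⟩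
  map (λ Z → ∣ X ⊕ Z ∣) (family M)               ∎)
  where open ≡-Reasoning

dist-* : ∀ (M : SetSystem n) S X → dist (M * S) X ≡ dist M (X ⊕ S)
dist-* M S X = cong minList (trans (sym (map-∘ (family M)))
  (map-cong (λ Z → cong ∣_∣ (⊕-Properties.x∙yz≈xz∙y X Z S)) (family M)))

Exchange : List (Subset n) → Set
Exchange D = ∀ X Y → X ∈ₗ D → Y ∈ₗ D → ∀ w → w ∈ X ⊕ Y →
  (X ⊕ ⁅ w ⁆) ∈ₗ D ⊎ (∃ λ v → v ∈ X ⊕ Y × v ≢ w × (X ⊕ (⁅ w ⁆ ∪ ⁅ v ⁆)) ∈ₗ D)

∈-map-⊕ : ∀ {D : List (Subset n)} {p q} r → p ⊕ q ∈ₗ D → (p ⊕ r) ⊕ q ∈ₗ map (_⊕ r) D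
∈-map-⊕ {D = D} {p} {q} r p⊕q∈D = subst (_∈ₗ map (_⊕ r) D) (⊕-Properties.xy∙z≈xz∙y p q r) (∈-map⁺ (_⊕ r) p⊕q∈D)

exchange-* : ∀ {D : List (Subset n)} S → Exchange D → Exchange (map (_⊕ S) D)
exchange-* S exchange X′ Y′ X′∈ Y′∈ w w∈X′⊕Y′
  with ∈-map⁻ (_⊕ S) X′∈ | ∈-map⁻ (_⊕ S) Y′∈
... | X , X∈D , refl | Y , Y∈D , refl
  with exchange X Y X∈D Y∈D w (subst (w ∈_) ([p⊕r]⊕[q⊕r]≡p⊕q X Y S) w∈X′⊕Y′)
... | inj₁ X⊕w∈D = inj₁ (∈-map-⊕ S X⊕w∈D)
... | inj₂ (v , v∈X⊕Y , v≢w , X⊕wv∈D) =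
  inj₂ (v , subst (v ∈_) (sym ([p⊕r]⊕[q⊕r]≡p⊕q X Y S)) v∈X⊕Y , v≢w , ∈-map-⊕ S X⊕wv∈D)

module _ {D : List (Subset n)} (exchange : Exchange D) where

  -- One exchange step at x moves a member containing x to a member avoiding x, toggling x and
  -- at most one further element; for X avoiding x the toggle of x brings it one step closer to X.
  exchange-avoiding : ∀ {x Z Y} → Z ∈ₗ D → x ∈ Z → Y ∈ₗ D → x ∉ Y →
                      ∃ λ Z′ → Z′ ∈ₗ D × x ∉ Z′ × (∀ {X} → x ∉ X → ∣ X ⊕ Z′ ∣ ≤ ∣ X ⊕ Z ∣)
  exchange-avoiding {x} {Z} {Y} Z∈D x∈Z Y∈D x∉Y
    with exchange Z Y Z∈D Y∈D x (x∈p⊕q⁺ (inj₁ (x∈Z , x∉Y)))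
  ... | inj₁ Z⊕x∈D = Z ⊕ ⁅ x ⁆ , Z⊕x∈D , x∈p∧x∈q⇒x∉p⊕q x∈Z (x∈⁅x⁆ x) , closer
    where
    closer : ∀ {X} → x ∉ X → ∣ X ⊕ (Z ⊕ ⁅ x ⁆) ∣ ≤ ∣ X ⊕ Z ∣
    closer {X} x∉X = subst (_≤ ∣ X ⊕ Z ∣) (cong ∣_∣ (⊕-assoc X Z ⁅ x ⁆))
                       (x∈p⇒∣p⊕⁅x⁆∣≤∣p∣ (x∈p⊕q⁺ (inj₂ (x∉X , x∈Z))))
  ... | inj₂ (y , _ , y≢x , Z⊕xy∈D) =
    Z ⊕ (⁅ x ⁆ ∪ ⁅ y ⁆) , Z⊕xy∈D , x∈p∧x∈q⇒x∉p⊕q x∈Z (x∈p∪q⁺ (inj₁ (x∈⁅x⁆ x))) , closer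
    where
    closer : ∀ {X} → x ∉ X → ∣ X ⊕ (Z ⊕ (⁅ x ⁆ ∪ ⁅ y ⁆)) ∣ ≤ ∣ X ⊕ Z ∣
    closer {X} x∉X = begin
      ∣ X ⊕ (Z ⊕ (⁅ x ⁆ ∪ ⁅ y ⁆)) ∣  ≡⟨ cong (λ T → ∣ X ⊕ (Z ⊕ T) ∣) (⁅x⁆∪⁅y⁆≡⁅x⁆⊕⁅y⁆ (y≢x ∘ sym)) ⟩
      ∣ X ⊕ (Z ⊕ (⁅ x ⁆ ⊕ ⁅ y ⁆)) ∣  ≡⟨ cong ∣_∣ (trans (sym (⊕-assoc X Z _)) (sym (⊕-assoc (X ⊕ Z) ⁅ x ⁆ ⁅ y ⁆))) ⟩
      ∣ ((X ⊕ Z) ⊕ ⁅ x ⁆) ⊕ ⁅ y ⁆ ∣  ≤⟨ ∣p⊕⁅x⁆∣≤1+∣p∣ ((X ⊕ Z) ⊕ ⁅ x ⁆) y ⟩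
      suc ∣ (X ⊕ Z) ⊕ ⁅ x ⁆ ∣        ≡⟨ x∈p⇒1+∣p⊕⁅x⁆∣≡∣p∣ (x∈p⊕q⁺ (inj₂ (x∉X , x∈Z))) ⟩
      ∣ X ⊕ Z ∣                      ∎
      where open ≤-Reasoning

  dist-∖ : ∀ {V : Subset n} {x Y X} → Y ∈ₗ D → x ∉ Y → x ∉ X → dist ((V , D) ∖ x) X ≡ dist (V , D) X
  dist-∖ {x = x} {Y} {X} Y∈D x∉Y x∉X = ≤-antisym
    (minList-map-mono distance Y∈D toAvoiding)
    (minList-map-mono distance {D} (∈-filter⁺ avoids? Y∈D x∉Y) λ Z∈ → _ , proj₁ (∈-filter⁻ avoids? Z∈) , ≤-refl)
    where
    avoids? = λ Z → ¬? (x ∈? Z)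
    distance = λ Z → ∣ X ⊕ Z ∣
    toAvoiding : ∀ {Z} → Z ∈ₗ D → ∃ λ Z′ → Z′ ∈ₗ filter avoids? D × ∣ X ⊕ Z′ ∣ ≤ ∣ X ⊕ Z ∣
    toAvoiding {Z} Z∈D with x ∈? Z
    ... | no x∉Z = Z , ∈-filter⁺ avoids? Z∈D x∉Z , ≤-refl
    ... | yes x∈Z with exchange-avoiding Z∈D x∈Z Y∈D x∉Y
    ...   | Z′ , Z′∈D , x∉Z′ , closer = Z′ , ∈-filter⁺ avoids? Z′∈D x∉Z′ , closer x∉X

q₁-recursion : ∀ {V : Subset n} {D x Zin Zout} → Exchange D → x ∈ V →
               Zin ∈ₗ D → x ∈ Zin → Zout ∈ₗ D → x ∉ Zout →
               q₁ (V , D) ≈ₚ (q₁ ((V , D) ∖ x) +ₚ q₁ (((V , D) * ⁅ x ⁆) ∖ x))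
q₁-recursion {V = V} {D} {x} exchange x∈V Zin∈D x∈Zin Zout∈D x∉Zout k = begin
  q₁ M k
    ≡⟨ q₁≡sumSubsets M k ⟩
  sumSubsets V (count M)
    ≡⟨ sumSubsets-pairs x∈V (count M) ⟩
  sumSubsets (V - x) (λ X → count M X + count M (X ⊕ ⁅ x ⁆))
    ≡⟨ sumSubsets-cong (V - x) (λ X⊆V-x → let x∉X = x∉p-x V x ∘ X⊆V-x in
         cong₂ _+_ (cong (λ m → indicator (m ≟ k)) (d-deleted x∉X))
                   (cong (λ m → indicator (m ≟ k)) (d-contracted x∉X))) ⟩
  sumSubsets (V - x) (λ X → count (M ∖ x) X + count ((M * ⁅ x ⁆) ∖ x) X)
    ≡⟨ sumSubsets-+ (V - x) (count (M ∖ x)) (count ((M * ⁅ x ⁆) ∖ x)) ⟩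
  sumSubsets (V - x) (count (M ∖ x)) + sumSubsets (V - x) (count ((M * ⁅ x ⁆) ∖ x))
    ≡⟨ cong₂ _+_ (q₁≡sumSubsets (M ∖ x) k) (q₁≡sumSubsets ((M * ⁅ x ⁆) ∖ x) k) ⟨
  q₁ (M ∖ x) k + q₁ ((M * ⁅ x ⁆) ∖ x) k ∎
  where
  open ≡-Reasoning
  M = V , D
  count = λ N X → indicator (d (N * X) ≟ k)
  d-deleted : ∀ {X} → x ∉ X → d (M * X) ≡ d ((M ∖ x) * X)
  d-deleted {X} x∉X = begin
    d (M * X)        ≡⟨ d-*≡dist M X ⟩
    dist M X         ≡⟨ dist-∖ exchange {V} Zout∈D x∉Zout x∉X ⟨
    dist (M ∖ x) X   ≡⟨ d-*≡dist (M ∖ x) X ⟨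
    d ((M ∖ x) * X)  ∎
  d-contracted : ∀ {X} → x ∉ X → d (M * (X ⊕ ⁅ x ⁆)) ≡ d (((M * ⁅ x ⁆) ∖ x) * X)
  d-contracted {X} x∉X = begin
    d (M * (X ⊕ ⁅ x ⁆))          ≡⟨ d-*≡dist M (X ⊕ ⁅ x ⁆) ⟩
    dist M (X ⊕ ⁅ x ⁆)           ≡⟨ dist-* M ⁅ x ⁆ X ⟨
    dist (M * ⁅ x ⁆) X           ≡⟨ dist-∖ (exchange-* ⁅ x ⁆ exchange) {V} (∈-map⁺ (_⊕ ⁅ x ⁆) Zin∈D) x∉Zin⊕x x∉X ⟨
    dist ((M * ⁅ x ⁆) ∖ x) X     ≡⟨ d-*≡dist ((M * ⁅ x ⁆) ∖ x) X ⟨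
    d (((M * ⁅ x ⁆) ∖ x) * X)    ∎
    where x∉Zin⊕x = x∈p∧x∈q⇒x∉p⊕q x∈Zin (x∈⁅x⁆ x)

divisibleBy⇒separated : ∀ {M : SetSystem n} {x} → DivisibleBy M x →
                        ∃₂ λ Zin Zout → Zin ∈M M × x ∈ Zin × Zout ∈M M × x ∉ Zout
divisibleBy⇒separated (Z₁ , Z₂ , Z₁∈M , Z₂∈M , x∈Z₁⊕Z₂) with x∈p⊕q⁻ Z₁ Z₂ x∈Z₁⊕Z₂
... | inj₁ (x∈Z₁ , x∉Z₂) = Z₁ , Z₂ , Z₁∈M , x∈Z₁ , Z₂∈M , x∉Z₂
... | inj₂ (x∉Z₁ , x∈Z₂) = Z₂ , Z₁ , Z₂∈M , x∈Z₂ , Z₁∈M , x∉Z₁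

nondivisible⇒unique : ∀ {M : SetSystem n} {Z Z′} → WellFormed M → ¬ Divisible M →
                      Z ∈M M → Z′ ∈M M → Z ≡ Z′
nondivisible⇒unique {Z = Z} {Z′} wf nondivisible Z∈M Z′∈M = p⊕q≡⊥⇒p≡q (Empty-unique noDifference)
  where
  noDifference : Empty (Z ⊕ Z′)
  noDifference (y , y∈Z⊕Z′) = nondivisible (y , y∈V , Z , Z′ , Z∈M , Z′∈M , y∈Z⊕Z′)
    where
    y∈V = [ wf Z Z∈M ∘ proj₁ , wf Z′ Z′∈M ∘ proj₂ ]′ (x∈p⊕q⁻ Z Z′ y∈Z⊕Z′)

dist-unique : ∀ {M : SetSystem n} {Z₀} → Z₀ ∈M M → (∀ {Z} → Z ∈M M → Z ≡ Z₀) → ∀ X → dist M X ≡ ∣ X ⊕ Z₀ ∣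
dist-unique Z₀∈M unique X with minList-map-∈ (λ Z → ∣ X ⊕ Z ∣) Z₀∈M
... | Z , Z∈M , dist≡ = trans dist≡ (cong (λ Z → ∣ X ⊕ Z ∣) (unique Z∈M))

q₁-unique : ∀ {M : SetSystem n} {Z₀} → WellFormed M → Z₀ ∈M M → (∀ {Z} → Z ∈M M → Z ≡ Z₀) →
            q₁ M ≈ₚ y+1^ ∣ ground M ∣
q₁-unique {M = M} {Z₀} wf Z₀∈M unique k = begin
  q₁ M k                                                ≡⟨ q₁≡sumSubsets M k ⟩
  sumSubsets (ground M) (λ X → indicator (d (M * X) ≟ k))
    ≡⟨ sumSubsets-cong (ground M) (λ {X} _ → cong (λ m → indicator (m ≟ k))
         (trans (d-*≡dist M X) (dist-unique {M = M} Z₀∈M unique X))) ⟩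
  sumSubsets (ground M) (λ X → indicator (∣ X ⊕ Z₀ ∣ ≟ k)) ≡⟨ sumSubsets-∣⊕∣≡ (wf Z₀ Z₀∈M) k ⟩
  y+1^ ∣ ground M ∣ k                                   ∎
  where open ≡-Reasoning

theorem16 : (n : ℕ) (V : Subset n) (D : List (Subset n)) →
    WellFormed (V , D) → IsDeltaMatroid (V , D) →
    (∀ u → u ∈ V → DivisibleBy (V , D) u →
      q₁ (V , D) ≈ₚ (q₁ ((V , D) ∖ u) +ₚ q₁ (((V , D) * ⁅ u ⁆) ∖ u)))
    × (¬ Divisible (V , D) → q₁ (V , D) ≈ₚ y+1^ ∣ V ∣)
theorem16 n V D wf ((Z₀ , Z₀∈D) , exchange) = recursion , nondivisible
  where
  recursion : ∀ u → u ∈ V → DivisibleBy (V , D) u →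
              q₁ (V , D) ≈ₚ (q₁ ((V , D) ∖ u) +ₚ q₁ (((V , D) * ⁅ u ⁆) ∖ u))
  recursion u u∈V divisible with divisibleBy⇒separated {M = V , D} divisible
  ... | _ , _ , Zin∈D , u∈Zin , Zout∈D , u∉Zout = q₁-recursion exchange u∈V Zin∈D u∈Zin Zout∈D u∉Zout
  nondivisible : ¬ Divisible (V , D) → q₁ (V , D) ≈ₚ y+1^ ∣ V ∣
  nondivisible nd = q₁-unique wf Z₀∈D (λ Z∈D → nondivisible⇒unique wf nd Z∈D Z₀∈D)
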